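{- For every 2D string $\mathcal{M}$ with $m$ rows and $n$ columns, $\delta(\mathcal{M})\le\gamma(\mathcal{M})$.
   Context: A 2D string $\mathcal{M}$ with $m$ rows and $n$ columns is an $m\times n$ matrix over a finite alphabet $\Sigma$. $\mathcal{M}[i_1..i_2][j_1..j_2]$ denotes the submatrix (factor) with top-left corner $(i_1,j_1)$ and bottom-right corner $(i_2,j_2)$. $P_\mathcal{M}(k_1,k_2)$ is the number of distinct $k_1\times k_2$ factors of $\mathcal{M}$, and $\delta(\mathcal{M})=\max\{P_\mathcal{M}(k_1,k_2)/(k_1k_2): 1\le k_1\le m, 1\le k_2\le n\}$. An attractor of $\mathcal{M}$ is a set $\Gamma\subseteq[1..m]\times[1..n]$ such that every factor $\mathcal{M}[i..j][k..l]$ has an occurrence $\mathcal{M}[i'..j'][k'..l']$ (an equal submatrix) for which some $(x,y)\in\Gamma$ satisfies $i'\le x\le j'$ and $k'\le y\le l'$. $\gamma(\mathcal{M})$ is the size of a smallest attractor. -}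

module Defs where

open import Data.Nat using (ℕ; zero; suc; _+_; _*_; _≤_; _<_; _≤?_)
open import Data.Nat.Properties using (≤-trans; +-monoʳ-<)
open import Data.Fin using (Fin; toℕ; fromℕ<)
open import Data.Fin.Properties using (toℕ<n)
open import Data.Vec using (Vec; tabulate)
open import Data.Vec.Properties using (≡-dec)
open import Data.List using (List; []; _∷_; length; upTo; concatMap; deduplicate; foldr)
open import Data.Product using (_×_; Σ; ∃; _,_)
open import Data.Integer using (+_)
open import Data.Rational using (ℚ; _/_; _⊔_; 0ℚ)
open import Relation.Nullary using (yes; no)
open import Relation.Binary.PropositionalEquality using (_≡_)
open import Data.List.Membership.Propositional using (_∈_)
import Data.Fin as F

-- A 2D string with m rows, n columns over the finite alphabet Fin σ.
-- Rows/columns are 0-indexed here (the paper uses 1-indexing).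
Matrix : ℕ → ℕ → ℕ → Set
Matrix σ m n = Fin m → Fin n → Fin σ

Block : ℕ → ℕ → ℕ → Set
Block σ k₁ k₂ = Vec (Vec (Fin σ) k₂) k₁

shift : ∀ {m} (i k : ℕ) → i + k ≤ m → Fin k → Fin m
shift i k p a = fromℕ< (≤-trans (+-monoʳ-< i (toℕ<n a)) p)

factor : ∀ {σ m n} → Matrix σ m n → (i j k₁ k₂ : ℕ) →
         i + k₁ ≤ m → j + k₂ ≤ n → Block σ k₁ k₂
factor M i j k₁ k₂ p q =
  tabulate λ a → tabulate λ b → M (shift i k₁ p a) (shift j k₂ q b)

allFactors : ∀ {σ m n} → Matrix σ m n → (k₁ k₂ : ℕ) → List (Block σ k₁ k₂)
allFactors {σ} {m} {n} M k₁ k₂ =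
  concatMap (λ i → concatMap (λ j → row i j (i + k₁ ≤? m) (j + k₂ ≤? n))
                             (upTo (suc n)))
            (upTo (suc m))
  where
  row : ∀ i j → _ → _ → List (Block σ k₁ k₂)
  row i j (yes p) (yes q) = factor M i j k₁ k₂ p q ∷ []
  row i j _ _ = []

P : ∀ {σ m n} → Matrix σ m n → ℕ → ℕ → ℕ
P M k₁ k₂ = length (deduplicate (≡-dec (≡-dec F._≟_)) (allFactors M k₁ k₂))

-- δ(M) = max { P_M(k₁,k₂) / (k₁ k₂) : 1 ≤ k₁ ≤ m, 1 ≤ k₂ ≤ n },
-- with k₁ = suc a, k₂ = suc b for a < m, b < n (0 if m or n is 0).
δ : ∀ {σ m n} → Matrix σ m n → ℚ
δ {σ} {m} {n} M =
  foldr _⊔_ 0ℚ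
    (concatMap (λ a → Data.List.map (λ b →
        (+ P M (suc a) (suc b)) / (suc a * suc b)) (upTo n)) (upTo m))
  where import Data.List

Pos : ℕ → ℕ → Set
Pos m n = Fin m × Fin n

IsAttractor : ∀ {σ m n} → Matrix σ m n → List (Pos m n) → Set
IsAttractor {σ} {m} {n} M Γ =
  ∀ (i j k₁ k₂ : ℕ) → 1 ≤ k₁ → 1 ≤ k₂ →
  (p : i + k₁ ≤ m) (q : j + k₂ ≤ n) →
  Σ ℕ λ i' → Σ ℕ λ j' → Σ (i' + k₁ ≤ m) λ p' → Σ (j' + k₂ ≤ n) λ q' →
    (factor M i' j' k₁ k₂ p' q' ≡ factor M i j k₁ k₂ p q) ×
    ∃ λ x → ∃ λ y → ((x , y) ∈ Γ) ×
      (i' ≤ toℕ x) × (toℕ x < i' + k₁) × (j' ≤ toℕ y) × (toℕ y < j' + k₂)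

{-# OPTIONS --safe #-}
-- Fix k₁, k₂ ≥ 1.  Every k₁ × k₂ factor has an occurrence containing a
-- position of the attractor Γ, and a position lies in at most k₁ k₂ windows
-- of that size (one per offset inside the window), so P(k₁,k₂) ≤ |Γ| k₁ k₂.
-- Dividing by k₁ k₂ and maximising gives δ ≤ |Γ|.  The bound holds for every
-- attractor.
module Submission where

open import Defs
open import Data.Nat using (ℕ)
open import Data.List using (List; length)
open import Data.List.Relation.Unary.Unique.Propositional using (Unique)
open import Data.Nat using (_≤_)
open import Data.Integer using (+_)
open import Data.Rational using (_/_)
import Data.Rational as Q

open import Data.Nat using (suc; _+_; _*_; _∸_; _<_; _≤?_; z≤n; s≤s)
open import Data.Nat.Properties
  using (≤-irrelevant; ≤-trans; +-mono-≤; *-identityʳ; m∸[m∸n]≡n; m+n∸m≡n; ∸-monoˡ-<;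
         module ≤-Reasoning)
open import Data.Fin using (toℕ)
open import Data.Product using (Σ; _,_)
open import Data.Empty using (⊥-elim)
open import Relation.Nullary using (yes; no)
open import Relation.Binary.PropositionalEquality
  using (_≡_; _≢_; refl; sym; cong₂; subst; subst₂)
open import Data.List using ([]; _∷_; concatMap; upTo)
open import Data.List.Properties using (length-++; length-upTo; length-removeAt′; foldr-preservesᵇ)
open import Data.List.Relation.Unary.Any using (here; there; index; satisfied; _─_)
import Data.List.Relation.Unary.All as All
open import Data.List.Relation.Unary.All.Properties using (concat⁺; map⁺)
open import Data.List.Relation.Unary.AllPairs using ([]; _∷_)
open import Data.List.Membership.Propositional using (_∈_; lose)
open import Data.List.Membership.Propositional.Properties
  using (∈-concatMap⁺; ∈-concatMap⁻; ∈-upTo⁺; ∈-deduplicate⁻)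
open import Data.List.Relation.Binary.Subset.Propositional using (_⊆_)
open import Data.List.Relation.Unary.Unique.DecPropositional.Properties using (deduplicate-!)
open import Data.Vec.Properties using (≡-dec)
import Data.Fin as F
import Data.Integer as ℤ
import Data.Integer.Properties as ℤ
import Data.Rational.Properties as Q
import Data.Rational.Unnormalised as ℚᵘ
import Data.Rational.Unnormalised.Properties as ℚᵘ

module _ {A : Set} where

  ∈-─⁺ : ∀ {x w} {ys : List A} (x∈ys : x ∈ ys) → w ∈ ys → w ≢ x → w ∈ (ys ─ x∈ys)
  ∈-─⁺ (here refl)  (here refl)  w≢x = ⊥-elim (w≢x refl)
  ∈-─⁺ (here refl)  (there w∈ys) _   = w∈ys
  ∈-─⁺ (there x∈ys) (here refl)  _   = here refl
  ∈-─⁺ (there x∈ys) (there w∈ys) w≢x = there (∈-─⁺ x∈ys w∈ys w≢x)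

  Unique-⊆⇒length≤ : ∀ {xs ys : List A} → Unique xs → xs ⊆ ys → length xs ≤ length ys
  Unique-⊆⇒length≤ [] _ = z≤n
  Unique-⊆⇒length≤ {x ∷ xs} {ys} (x∉xs ∷ xs!) xs⊆ys = begin
    suc (length xs)           ≤⟨ s≤s (Unique-⊆⇒length≤ xs! xs⊆ys─x) ⟩
    suc (length (ys ─ x∈ys))  ≡⟨ sym (length-removeAt′ ys (index x∈ys)) ⟩
    length ys                 ∎
    where
    open ≤-Reasoning
    x∈ys : x ∈ ys
    x∈ys = xs⊆ys (here refl)
    xs⊆ys─x : xs ⊆ (ys ─ x∈ys)
    xs⊆ys─x w∈xs = ∈-─⁺ x∈ys (xs⊆ys (there w∈xs)) (λ w≡x → All.lookup x∉xs w∈xs (sym w≡x))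

  length-concatMap-≤ : ∀ {B : Set} (f : A → List B) {c} (xs : List A) →
                       (∀ x → length (f x) ≤ c) → length (concatMap f xs) ≤ length xs * c
  length-concatMap-≤ f []       _     = z≤n
  length-concatMap-≤ f (x ∷ xs) bound =
    subst (_≤ _) (sym (length-++ (f x))) (+-mono-≤ (bound x) (length-concatMap-≤ f xs bound))

length-concatMap-upTo-≤ : ∀ {B : Set} (f : ℕ → List B) {c} k →
                          (∀ a → length (f a) ≤ c) → length (concatMap f (upTo k)) ≤ k * c
length-concatMap-upTo-≤ f {c} k bound =
  subst (λ l → length (concatMap f (upTo k)) ≤ l * c) (length-upTo k)
    (length-concatMap-≤ f (upTo k) bound)

fromℚᵘ-mono-≤ : ∀ {p q} → p ℚᵘ.≤ q → Q.fromℚᵘ p Q.≤ Q.fromℚᵘ q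
fromℚᵘ-mono-≤ {p} {q} p≤q = Q.toℚᵘ-cancel-≤
  (ℚᵘ.≤-respˡ-≃ (ℚᵘ.≃-sym (Q.toℚᵘ-fromℚᵘ p)) (ℚᵘ.≤-respʳ-≃ (ℚᵘ.≃-sym (Q.toℚᵘ-fromℚᵘ q)) p≤q))

-- (+ n) / suc d is definitionally fromℚᵘ (mkℚᵘ (+ n) d), so the comparison
-- can be made by cross-multiplying the unnormalised fractions.
n≤m*[1+d]⇒n/[1+d]≤m : ∀ n m {d} → n ≤ m * suc d → (+ n) / suc d Q.≤ (+ m) / 1
n≤m*[1+d]⇒n/[1+d]≤m n m {d} n≤m*[1+d] =
  fromℚᵘ-mono-≤ {ℚᵘ.mkℚᵘ (+ n) d} {ℚᵘ.mkℚᵘ (+ m) 0} (ℚᵘ.*≤*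
    (subst₂ ℤ._≤_ (ℤ.pos-* n 1) (ℤ.pos-* m (suc d))
      (ℤ.+≤+ (subst (_≤ m * suc d) (sym (*-identityʳ n)) n≤m*[1+d]))))

module _ {σ m n : ℕ} (M : Matrix σ m n) {k₁ k₂ : ℕ} where

  window : ℕ → ℕ → List (Block σ k₁ k₂)
  window i j with i + k₁ ≤? m | j + k₂ ≤? n
  ... | yes p | yes q = factor M i j k₁ k₂ p q ∷ []
  ... | _     | _     = []

  length-window : ∀ i j → length (window i j) ≤ 1
  length-window i j with i + k₁ ≤? m | j + k₂ ≤? n
  ... | yes _ | yes _ = s≤s z≤n
  ... | yes _ | no  _ = z≤n
  ... | no  _ | _     = z≤n

  factor-∈-window : ∀ {i j} (p : i + k₁ ≤ m) (q : j + k₂ ≤ n) → factor M i j k₁ k₂ p q ∈ window i j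
  factor-∈-window {i} {j} p q with i + k₁ ≤? m | j + k₂ ≤? n
  ... | yes p′ | yes q′ = here (cong₂ (factor M i j k₁ k₂) (≤-irrelevant p p′) (≤-irrelevant q q′))
  ... | yes _  | no ¬q  = ⊥-elim (¬q q)
  ... | no ¬p  | _      = ⊥-elim (¬p p)

  ∈-allFactors⁻ : ∀ {B} → B ∈ allFactors M k₁ k₂ →
    Σ ℕ λ i → Σ ℕ λ j → Σ (i + k₁ ≤ m) λ p → Σ (j + k₂ ≤ n) λ q → B ≡ factor M i j k₁ k₂ p q
  ∈-allFactors⁻ B∈ with satisfied (∈-concatMap⁻ _ {xs = upTo (suc m)} B∈)
  ... | i , B∈row with satisfied (∈-concatMap⁻ _ {xs = upTo (suc n)} B∈row)
  ... | j , B∈cell with i + k₁ ≤? m | j + k₂ ≤? n | B∈cell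
  ... | yes p | yes q | here B≡ = i , j , p , q , B≡

  -- Near the top or left border the truncated subtraction x ∸ a repeats the
  -- window at row 0 (resp. column 0); this only overcounts.
  windowsThrough : ℕ → ℕ → List (Block σ k₁ k₂)
  windowsThrough x y =
    concatMap (λ a → concatMap (λ b → window (x ∸ a) (y ∸ b)) (upTo k₂)) (upTo k₁)

  length-windowsThrough : ∀ x y → length (windowsThrough x y) ≤ k₁ * k₂
  length-windowsThrough x y = length-concatMap-upTo-≤ windowsAtRowOffset k₁ λ a →
    subst (length (windowsAtRowOffset a) ≤_) (*-identityʳ k₂)
      (length-concatMap-upTo-≤ (λ b → window (x ∸ a) (y ∸ b)) k₂ λ b →
        length-window (x ∸ a) (y ∸ b))
    where
    windowsAtRowOffset : ℕ → List (Block σ k₁ k₂)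
    windowsAtRowOffset a = concatMap (λ b → window (x ∸ a) (y ∸ b)) (upTo k₂)

  factor-∈-windowsThrough : ∀ {i j x y} (p : i + k₁ ≤ m) (q : j + k₂ ≤ n) →
    i ≤ x → x < i + k₁ → j ≤ y → y < j + k₂ → factor M i j k₁ k₂ p q ∈ windowsThrough x y
  factor-∈-windowsThrough {i} {j} {x} {y} p q i≤x x<i+k₁ j≤y y<j+k₂ =
    ∈-concatMap⁺ _ {xs = upTo k₁} (lose (∈-upTo⁺ (offset<size i≤x x<i+k₁))
      (∈-concatMap⁺ _ {xs = upTo k₂} (lose (∈-upTo⁺ (offset<size j≤y y<j+k₂))
        (subst₂ (λ i′ j′ → factor M i j k₁ k₂ p q ∈ window i′ j′)
          (sym (m∸[m∸n]≡n i≤x)) (sym (m∸[m∸n]≡n j≤y)) (factor-∈-window p q)))))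
    where
    offset<size : ∀ {s z k} → s ≤ z → z < s + k → z ∸ s < k
    offset<size {s} {k = k} s≤z z<s+k = subst (_ <_) (m+n∸m≡n s k) (∸-monoˡ-< z<s+k s≤z)

  windowsThroughAll : List (Pos m n) → List (Block σ k₁ k₂)
  windowsThroughAll = concatMap λ (x , y) → windowsThrough (toℕ x) (toℕ y)

  allFactors-⊆-windowsThroughAll : ∀ {Γ} → IsAttractor M Γ → 1 ≤ k₁ → 1 ≤ k₂ →
                                    allFactors M k₁ k₂ ⊆ windowsThroughAll Γ
  allFactors-⊆-windowsThroughAll {Γ} attractor 1≤k₁ 1≤k₂ B∈ with ∈-allFactors⁻ B∈
  ... | i , j , p , q , refl with attractor i j k₁ k₂ 1≤k₁ 1≤k₂ p q
  ... | i′ , j′ , p′ , q′ , same , x , y , xy∈Γ , i′≤x , x<i′+k₁ , j′≤y , y<j′+k₂ =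
    ∈-concatMap⁺ _ {xs = Γ} (lose xy∈Γ
      (subst (_∈ _) same (factor-∈-windowsThrough p′ q′ i′≤x x<i′+k₁ j′≤y y<j′+k₂)))

  P≤|attractor|*area : ∀ {Γ} → IsAttractor M Γ → 1 ≤ k₁ → 1 ≤ k₂ →
                       P M k₁ k₂ ≤ length Γ * (k₁ * k₂)
  P≤|attractor|*area {Γ} attractor 1≤k₁ 1≤k₂ = ≤-trans
    (Unique-⊆⇒length≤ (deduplicate-! (≡-dec (≡-dec F._≟_)) (allFactors M k₁ k₂))
      (λ B∈ → allFactors-⊆-windowsThroughAll attractor 1≤k₁ 1≤k₂ (∈-deduplicate⁻ _ _ B∈)))
    (length-concatMap-≤ _ Γ λ (x , y) → length-windowsThrough (toℕ x) (toℕ y))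

δ≤ : ∀ {σ m n} (M : Matrix σ m n) {g} → Q.0ℚ Q.≤ g →
     (∀ a b → (+ P M (suc a) (suc b)) / (suc a * suc b) Q.≤ g) → δ M Q.≤ g
δ≤ {m = m} {n} M {g} 0≤g ratio≤g = foldr-preservesᵇ {P = Q._≤ g} Q.⊔-lub 0≤g
  (concat⁺ (map⁺ (All.universal (λ a → map⁺ (All.universal (ratio≤g a) (upTo n))) (upTo m))))

proposition1 : ∀ {σ m n} (M : Matrix σ m n) (Γ : List (Pos m n)) →
    Unique Γ → IsAttractor M Γ →
    (∀ (Γ' : List (Pos m n)) → Unique Γ' → IsAttractor M Γ' → length Γ ≤ length Γ') →
    δ M Q.≤ (+ length Γ) / 1
proposition1 M Γ _ attractor _ = δ≤ M (n≤m*[1+d]⇒n/[1+d]≤m 0 (length Γ) {0} z≤n) λ a b →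
  n≤m*[1+d]⇒n/[1+d]≤m (P M (suc a) (suc b)) (length Γ)
    (P≤|attractor|*area M attractor (s≤s z≤n) (s≤s z≤n))
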